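{- The equation $x^4+9x^2y^2+27y^4=z^2$ has no solution in integers $x,y,z$ that are all nonzero. -}

-- A descent on b, carried out in ℕ. Dividing a solution by gcd a b gives a coprime one, and then
-- 3 ∤ a. Writing b = 2w (for odd b, first pass to (2a, 2b, 4c) and take w = b), the equation reads
-- X² = (A² + 18w²)² + 4·27w⁴, so X = 2F + A² + 18w² with coprime factors F·(F + A² + 18w²) = 27w⁴.
-- Modulo 3 this forces F = 27r⁴ and F + A² + 18w² = s⁴ with rs = w, that is
-- (s² − 9r²)² = A² + 4·27r⁴. Splitting this equation in the same way gives r = r′s′ and
-- s² = r′⁴ + 9r′²s′² + 27s′⁴ (possibly with r′ and s′ exchanged): a new solution whose b divides r,
-- and r < w ≤ b.
module Submission where

module _ where
  open import Data.Nat
  open import Data.Nat.Properties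
  open import Data.Nat.Induction using (<-rec)
  open import Data.Nat.Divisibility
  open import Data.Nat.DivMod using (_/_; _%_; m*[n/m]≡n; %-distribˡ-+; %-distribˡ-*; m%n<n)
  open import Data.Nat.GCD using (gcd; gcd[m,n]∣m; gcd[m,n]∣n; gcd[m,n]≢0)
  open import Data.Nat.Coprimality as Coprime using (Coprime; coprime-/gcd; coprime-divisor; 0-coprimeTo-m⇒m≡1)
  open import Data.Nat.Primality using (Prime; prime?; prime[2]; ¬prime[1]; euclidsLemma; prime⇒irreducible; prime⇒nonZero)
  open import Data.Nat.Primality.Factorisation using (factorise)
  open import Data.Nat.ListAction using (product)
  open import Data.Nat.Tactic.RingSolver using (solve-∀)
  open import Data.List.Base using ([]; _∷_)
  open import Data.List.Relation.Unary.All using (_∷_)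
  open import Data.Product using (∃₂; ∃-syntax; _×_; _,_)
  open import Data.Sum using (_⊎_; inj₁; inj₂)
  open import Relation.Binary.PropositionalEquality
  open import Relation.Nullary using (¬_; contradiction)
  open import Relation.Nullary.Decidable using (decidable-stable; from-yes)
  open import Function.Base using (case_of_)

  private variable
    a b c d m n p q r s t w X Y : ℕ

  -- Primes and coprimality

  prime∣m*m⇒∣m : Prime p → p ∣ m * m → p ∣ m
  prime∣m*m⇒∣m {m = m} p-prime p∣m*m with euclidsLemma m m p-prime p∣m*m
  ... | inj₁ p∣m = p∣m
  ... | inj₂ p∣m = p∣m

  prime∣m*m+n⇒∣m : Prime p → p ∣ n → p ∣ m * m + n → p ∣ m
  prime∣m*m+n⇒∣m {p} {n} {m} p-prime p∣n p∣m*m+n =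
    prime∣m*m⇒∣m p-prime (∣m+n∣m⇒∣n (subst (p ∣_) (+-comm (m * m) n) p∣m*m+n) p∣n)

  prime∣prime⇒≡ : Prime p → Prime q → q ∣ p → q ≡ p
  prime∣prime⇒≡ p-prime q-prime q∣p with prime⇒irreducible p-prime q∣p
  ... | inj₁ refl = contradiction q-prime ¬prime[1]
  ... | inj₂ q≡p = q≡p

  prime[3] : Prime 3
  prime[3] = from-yes (prime? 3)

  prime-divisor : n ≢ 1 → ∃[ p ] Prime p × p ∣ n
  prime-divisor {zero} _ = 2 , prime[2] , 2 ∣0
  prime-divisor {suc n} n≢1 with factorise (suc n)
  ... | record { factors = [] ; isFactorisation = n≡1 } = contradiction n≡1 n≢1
  ... | record { factors = p ∷ ps ; isFactorisation = n≡p*ps ; factorsPrime = p-prime ∷ _ } =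
    p , p-prime , divides (product ps) (trans n≡p*ps (*-comm p (product ps)))

  no-common-prime⇒coprime : (∀ {p} → Prime p → p ∣ m → p ∤ n) → Coprime m n
  no-common-prime⇒coprime no-common {d} (d∣m , d∣n) = decidable-stable (d ≟ 1) λ d≢1 →
    let p , p-prime , p∣d = prime-divisor d≢1
    in no-common p-prime (∣-trans p∣d d∣m) (∣-trans p∣d d∣n)

  coprime⇒∤ : Coprime m n → Prime p → p ∣ m → p ∤ n
  coprime⇒∤ coprime p-prime p∣m p∣n = ¬prime[1] (subst Prime (coprime (p∣m , p∣n)) p-prime)

  coprime-∣ˡ : d ∣ m → Coprime m n → Coprime d n
  coprime-∣ˡ d∣m coprime (e∣d , e∣n) = coprime (∣-trans e∣d d∣m , e∣n)

  coprime-∣ʳ : d ∣ n → Coprime m n → Coprime m d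
  coprime-∣ʳ d∣n coprime = Coprime.sym (coprime-∣ˡ d∣n (Coprime.sym coprime))

  prime∤⇒coprime-cube : Prime p → p ∤ n → Coprime (p * p * p) n
  prime∤⇒coprime-cube {p} p-prime p∤n = no-common-prime⇒coprime λ q-prime q∣p³ q∣n →
    p∤n (subst (_∣ _) (prime∣prime⇒≡ p-prime q-prime (q∣p q-prime q∣p³)) q∣n)
    where
    q∣p : ∀ {q} → Prime q → q ∣ p * p * p → q ∣ p
    q∣p q-prime q∣p³ with euclidsLemma (p * p) p q-prime q∣p³
    ... | inj₁ q∣p² = prime∣m*m⇒∣m q-prime q∣p²
    ... | inj₂ q∣p = q∣p

  gcd-factorisation : ∀ m n → m ≢ 0 ⊎ n ≢ 0 →
    ∃₂ λ m′ n′ → Coprime m′ n′ × m ≡ gcd m n * m′ × n ≡ gcd m n * n′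
  gcd-factorisation m n m≢0⊎n≢0 = m / gcd m n , n / gcd m n , coprime-/gcd m n ,
    sym (m*[n/m]≡n (gcd[m,n]∣m m n)) , sym (m*[n/m]≡n (gcd[m,n]∣n m n))
    where
    instance
      g≢0 : NonZero (gcd m n)
      g≢0 = ≢-nonZero (gcd[m,n]≢0 m n m≢0⊎n≢0)

  -- Coprime factors of squares and fourth powers

  m*m≡0⇒m≡0 : m * m ≡ 0 → m ≡ 0
  m*m≡0⇒m≡0 {m} m*m≡0 with m*n≡0⇒m≡0∨n≡0 m m*m≡0
  ... | inj₁ m≡0 = m≡0
  ... | inj₂ m≡0 = m≡0

  m*m∣n*n⇒m∣n : m * m ∣ n * n → m ∣ n
  m*m∣n*n⇒m∣n {zero} {n} 0∣n*n = subst (0 ∣_) (sym (m*m≡0⇒m≡0 (0∣⇒≡0 0∣n*n))) (0 ∣0)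
  m*m∣n*n⇒m∣n {m@(suc _)} {n} m*m∣n*n =
    let m′ , n′ , coprime′ , m≡g*m′ , n≡g*n′ = gcd-factorisation m n (inj₁ λ ())
        m′*m′∣n′*n′ = *-cancelˡ-∣ (g * g) (subst₂ _∣_ (regroup g m′) (regroup g n′)
                        (subst₂ (λ k l → k * k ∣ l * l) m≡g*m′ n≡g*n′ m*m∣n*n))
        m′≡1 = coprime′ (∣-refl , coprime-divisor coprime′ (∣-trans (m∣m*n m′) m′*m′∣n′*n′))
    in subst (_∣ n) (sym (trans m≡g*m′ (trans (cong (g *_) m′≡1) (*-identityʳ g)))) (gcd[m,n]∣n m n)
    where
    g : ℕ
    g = gcd m n
    instance
      g≢0 : NonZero g
      g≢0 = ≢-nonZero (gcd[m,n]≢0 m n (inj₁ λ ()))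
      g*g≢0 : NonZero (g * g)
      g*g≢0 = m*n≢0 g g
    regroup : ∀ g k → g * k * (g * k) ≡ g * g * (k * k)
    regroup = solve-∀

  prime*m≡square⇒ : Prime p → p * m ≡ c * c → ∃[ d ] m ≡ p * (d * d)
  prime*m≡square⇒ {p} {m} {c} p-prime pm≡c*c
    with prime∣m*m⇒∣m {m = c} p-prime (divides m (trans (sym pm≡c*c) (*-comm p m)))
  ... | divides d refl = d , *-cancelˡ-≡ _ _ p {{prime⇒nonZero p-prime}} (trans pm≡c*c (regroup d p))
    where
    regroup : ∀ d p → d * p * (d * p) ≡ p * (p * (d * d))
    regroup = solve-∀

  prime-cube*m≡square⇒ : Prime p → p * p * p * m ≡ c * c → ∃[ d ] m ≡ p * (d * d)
  prime-cube*m≡square⇒ {p} {m} {c} p-prime p³m≡c*c =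
    let d₁ , p*p*m≡p*d₁*d₁ = prime*m≡square⇒ {c = c} p-prime (trans (regroup p m) p³m≡c*c)
    in prime*m≡square⇒ {c = d₁} p-prime (*-cancelˡ-≡ _ _ p {{prime⇒nonZero p-prime}} p*p*m≡p*d₁*d₁)
    where
    regroup : ∀ p m → p * (p * (p * m)) ≡ p * p * p * m
    regroup = solve-∀

  coprime-square-factors : Coprime m n → m * n ≡ c * c →
    ∃₂ λ u v → m ≡ u * u × n ≡ v * v × u * v ≡ c
  coprime-square-factors {zero} {n} {c} coprime 0≡c*c =
    0 , 1 , refl , 0-coprimeTo-m⇒m≡1 coprime , sym (m*m≡0⇒m≡0 (sym 0≡c*c))
  coprime-square-factors {m@(suc _)} {n} {c} coprime m*n≡c*c with gcd-factorisation m c (inj₁ λ ())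
  ... | m′ , c′ , coprime′ , m≡g*m′ , c≡g*c′ =
    g , c′ , trans m≡g*m′ (cong (g *_) m′≡g) , n≡c′*c′ , sym c≡g*c′
    where
    g : ℕ
    g = gcd m c
    instance
      g≢0 : NonZero g
      g≢0 = ≢-nonZero (gcd[m,n]≢0 m c (inj₁ λ ()))
    m′*n≡c′*c′*g : m′ * n ≡ c′ * (c′ * g)
    m′*n≡c′*c′*g = *-cancelˡ-≡ _ _ g (begin
      g * (m′ * n)         ≡⟨ *-assoc g m′ n ⟨
      g * m′ * n           ≡⟨ cong (_* n) m≡g*m′ ⟨
      m * n                ≡⟨ m*n≡c*c ⟩
      c * c                ≡⟨ cong (λ x → x * x) c≡g*c′ ⟩
      g * c′ * (g * c′)    ≡⟨ regroup g c′ ⟩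
      g * (c′ * (c′ * g))  ∎)
      where
      open ≡-Reasoning
      regroup : ∀ g c → g * c * (g * c) ≡ g * (c * (c * g))
      regroup = solve-∀
    m′≡g : m′ ≡ g
    m′≡g = ∣-antisym
      (coprime-divisor coprime′ (coprime-divisor coprime′ (subst (m′ ∣_) m′*n≡c′*c′*g (m∣m*n n))))
      (coprime-divisor (coprime-∣ˡ (gcd[m,n]∣m m c) coprime)
        (divides (c′ * c′) (trans (*-comm n m′) (trans m′*n≡c′*c′*g (sym (*-assoc c′ c′ g))))))
    n≡c′*c′ : n ≡ c′ * c′
    n≡c′*c′ = *-cancelˡ-≡ _ _ g
      (trans (subst (λ k → k * n ≡ c′ * (c′ * g)) m′≡g m′*n≡c′*c′*g) (regroup c′ g))
      where
      regroup : ∀ c g → c * (c * g) ≡ g * (c * c)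
      regroup = solve-∀

  coprime-fourth-power-factors : Coprime m n → m * n ≡ c * c * (c * c) →
    ∃₂ λ r s → m ≡ r * r * (r * r) × n ≡ s * s * (s * s) × r * s ≡ c
  coprime-fourth-power-factors coprime m*n≡c⁴ =
    let u , v , m≡u*u , n≡v*v , u*v≡c*c = coprime-square-factors coprime m*n≡c⁴
        coprime-uv = coprime-∣ʳ (divides v n≡v*v) (coprime-∣ˡ (divides u m≡u*u) coprime)
        r , s , u≡r*r , v≡s*s , r*s≡c = coprime-square-factors coprime-uv u*v≡c*c
    in r , s , trans m≡u*u (cong₂ _*_ u≡r*r u≡r*r) , trans n≡v*v (cong₂ _*_ v≡s*s v≡s*s) , r*s≡c

  private
    coprime-cube-splitˡ : Prime p → Coprime m n → p ∣ m → m * n ≡ p * p * p * (c * c * (c * c)) →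
      ∃₂ λ r s → r * s ≡ c × m ≡ p * p * p * (r * r * (r * r)) × n ≡ s * s * (s * s)
    coprime-cube-splitˡ {p} {m} {n} {c} p-prime coprime p∣m m*n≡p³c⁴ =
      let divides m′ m≡m′*p³ = coprime-divisor (prime∤⇒coprime-cube p-prime (coprime⇒∤ coprime p-prime p∣m))
                                 (subst (p * p * p ∣_) (trans (sym m*n≡p³c⁴) (*-comm m n)) (m∣m*n _))
          m′*n≡c⁴ = *-cancelˡ-≡ _ _ (p * p * p) (trans (regroup m′ (p * p * p) n)
                      (trans (cong (_* n) (sym m≡m′*p³)) m*n≡p³c⁴))
          m′∣m = divides (p * p * p) (trans m≡m′*p³ (*-comm m′ _))
          r , s , m′≡r⁴ , n≡s⁴ , r*s≡c = coprime-fourth-power-factors (coprime-∣ˡ m′∣m coprime) m′*n≡c⁴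
      in r , s , r*s≡c , trans m≡m′*p³ (trans (*-comm m′ _) (cong (p * p * p *_) m′≡r⁴)) , n≡s⁴
      where
      instance
        p≢0 : NonZero p
        p≢0 = prime⇒nonZero p-prime
        p³≢0 : NonZero (p * p * p)
        p³≢0 = m*n≢0 (p * p) p {{m*n≢0 p p}}
      regroup : ∀ m′ q n → q * (m′ * n) ≡ m′ * q * n
      regroup = solve-∀

  coprime-cube-split : Prime p → Coprime m n → m * n ≡ p * p * p * (c * c * (c * c)) →
    ∃₂ λ r s → r * s ≡ c ×
      (m ≡ r * r * (r * r) × n ≡ p * p * p * (s * s * (s * s)) ⊎
       m ≡ p * p * p * (r * r * (r * r)) × n ≡ s * s * (s * s))
  coprime-cube-split {p} {m} {n} {c} p-prime coprime m*n≡p³c⁴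
    with euclidsLemma m n p-prime (subst (p ∣_) (sym m*n≡p³c⁴) (∣m⇒∣m*n _ (∣m⇒∣m*n p (m∣m*n p))))
  ... | inj₁ p∣m =
    let r , s , r*s≡c , m≡p³r⁴ , n≡s⁴ = coprime-cube-splitˡ p-prime coprime p∣m m*n≡p³c⁴
    in r , s , r*s≡c , inj₂ (m≡p³r⁴ , n≡s⁴)
  ... | inj₂ p∣n =
    let r , s , r*s≡c , n≡p³r⁴ , m≡s⁴ = coprime-cube-splitˡ p-prime (Coprime.sym coprime) p∣n
                                          (trans (*-comm n m) m*n≡p³c⁴)
    in s , r , trans (*-comm s r) r*s≡c , inj₁ (m≡s⁴ , n≡p³r⁴)

  -- Parity and residues

  even⊎odd : ∀ n → ∃[ k ] (n ≡ 2 * k ⊎ n ≡ suc (2 * k))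
  even⊎odd zero = 0 , inj₁ refl
  even⊎odd (suc n) with even⊎odd n
  ... | k , inj₁ n≡2k = k , inj₂ (cong suc n≡2k)
  ... | k , inj₂ n≡1+2k = suc k , inj₁ (trans (cong suc n≡1+2k) (sym (*-suc 2 k)))

  m*m≡n*n+4k⇒ : ∀ m n k → m * m ≡ n * n + 4 * k → ∃[ f ] f * (f + n) ≡ k × m ≡ f + (f + n)
  m*m≡n*n+4k⇒ m n k m*m≡n*n+4k with m≤n⇒∃[o]m+o≡n n≤m
    where
    n≤m : n ≤ m
    n≤m = ≮⇒≥ λ m<n → <-irrefl m*m≡n*n+4k (<-≤-trans (*-mono-< m<n m<n) (m≤m+n (n * n) (4 * k)))
  ... | d , refl with even⊎odd d | +-cancelˡ-≡ (n * n) _ _ (trans (sym (expand n d)) m*m≡n*n+4k)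
    where
    expand : ∀ n d → (n + d) * (n + d) ≡ n * n + d * (d + 2 * n)
    expand = solve-∀
  ... | f , inj₁ refl | 2f[2f+2n]≡4k = f , *-cancelˡ-≡ _ _ 4 (trans (expand-even f n) 2f[2f+2n]≡4k) , regroup n f
    where
    expand-even : ∀ f n → 4 * (f * (f + n)) ≡ 2 * f * (2 * f + 2 * n)
    expand-even = solve-∀
    regroup : ∀ n f → n + 2 * f ≡ f + (f + n)
    regroup = solve-∀
  ... | f , inj₂ refl | odd≡4k =
    contradiction (trans (sym (*-assoc 2 2 k)) (sym (trans (expand-odd f n) odd≡4k)))
                  (even≢odd (2 * k) (2 * f + 2 * (f * f) + n + 2 * (f * n)))
    where
    expand-odd : ∀ f n → suc (2 * (2 * f + 2 * (f * f) + n + 2 * (f * n))) ≡ suc (2 * f) * (suc (2 * f) + 2 * n)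
    expand-odd = solve-∀

  3∣m*m+n*n⇒3∣m : 3 ∣ m * m + n * n → 3 ∣ m
  3∣m*m+n*n⇒3∣m {m} {n} 3∣m²+n² = m%n≡0⇒n∣m m 3 (residues (m % 3) (n % 3) (m%n<n m 3) (m%n<n n 3) (begin
      (m % 3 * (m % 3) + n % 3 * (n % 3)) % 3          ≡⟨ %-distribˡ-+ (m % 3 * (m % 3)) _ 3 ⟩
      (m % 3 * (m % 3) % 3 + n % 3 * (n % 3) % 3) % 3  ≡⟨ cong₂ (λ k l → (k + l) % 3) (%-distribˡ-* m m 3)
                                                                                    (%-distribˡ-* n n 3) ⟨
      (m * m % 3 + n * n % 3) % 3                      ≡⟨ %-distribˡ-+ (m * m) (n * n) 3 ⟨
      (m * m + n * n) % 3                              ≡⟨ n∣m⇒m%n≡0 _ 3 3∣m²+n² ⟩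
      0                                                ∎))
    where
    open ≡-Reasoning
    residues : ∀ i j → i < 3 → j < 3 → (i * i + j * j) % 3 ≡ 0 → i ≡ 0
    residues 0 _ _ _ _ = refl
    residues 1 0 _ _ ()
    residues 1 1 _ _ ()
    residues 1 2 _ _ ()
    residues 2 0 _ _ ()
    residues 2 1 _ _ ()
    residues 2 2 _ _ ()
    residues (suc (suc (suc _))) _ (s≤s (s≤s (s≤s ()))) _ _
    residues (suc _) (suc (suc (suc _))) _ (s≤s (s≤s (s≤s ()))) _

  ∣⇒0< : d ∣ n → 0 < n → 0 < d
  ∣⇒0< {zero} 0∣n 0<n with 0∣⇒≡0 0∣n
  ... | refl = 0<n
  ∣⇒0< {suc _} _ _ = z<s

  -- The descent

  record Solution (a b c : ℕ) : Set where
    constructor solution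
    field
      equation : a * a * (a * a) + 9 * (a * a) * (b * b) + 27 * (b * b * (b * b)) ≡ c * c

  private
    form-scale : ∀ k a b →
      k * a * (k * a) * (k * a * (k * a)) + 9 * (k * a * (k * a)) * (k * b * (k * b)) + 27 * (k * b * (k * b) * (k * b * (k * b)))
      ≡ k * k * (k * k) * (a * a * (a * a) + 9 * (a * a) * (b * b) + 27 * (b * b * (b * b)))
    form-scale = solve-∀

    square-scale : ∀ k c → k * k * c * (k * k * c) ≡ k * k * (k * k) * (c * c)
    square-scale = solve-∀

  scale-solution : ∀ k → Solution a b c → Solution (k * a) (k * b) (k * k * c)
  scale-solution {a} {b} {c} k (solution eq) =
    solution (trans (form-scale k a b) (trans (cong (k * k * (k * k) *_) eq) (sym (square-scale k c))))

  unscale-solution : ∀ k .{{_ : NonZero k}} → Solution (k * a) (k * b) c → ∃[ c′ ] Solution a b c′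
  unscale-solution {a} {b} {c} k (solution eq) =
    let divides c′ c≡c′*k² = m*m∣n*n⇒m∣n {k * k} {c}
          (divides Q (trans (sym eq) (trans (form-scale k a b) (*-comm (k * k * (k * k)) Q))))
    in c′ , solution (*-cancelˡ-≡ _ _ (k * k * (k * k)) {{k⁴≢0}}
              (trans (sym (form-scale k a b)) (trans eq (trans (cong (λ x → x * x) c≡c′*k²) (square-scale′ c′ k)))))
    where
    Q : ℕ
    Q = a * a * (a * a) + 9 * (a * a) * (b * b) + 27 * (b * b * (b * b))
    k⁴≢0 : NonZero (k * k * (k * k))
    k⁴≢0 = m*n≢0 (k * k) (k * k) {{m*n≢0 k k}} {{m*n≢0 k k}}
    square-scale′ : ∀ c k → c * (k * k) * (c * (k * k)) ≡ k * k * (k * k) * (c * c)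
    square-scale′ = solve-∀

  primitive-solution : 0 < b → Solution a b c →
    ∃[ a′ ] ∃[ b′ ] ∃[ c′ ] Coprime a′ b′ × b′ ∣ b × Solution a′ b′ c′
  primitive-solution {b} {a} {c} 0<b sol =
    let a′ , b′ , coprime , a≡g*a′ , b≡g*b′ = gcd-factorisation a b (inj₂ b≢0)
        c′ , sol′ = unscale-solution g (subst₂ (λ x y → Solution x y c) a≡g*a′ b≡g*b′ sol)
    in a′ , b′ , c′ , coprime , divides g b≡g*b′ , sol′
    where
    b≢0 : b ≢ 0
    b≢0 = ≢-nonZero⁻¹ b {{>-nonZero 0<b}}
    g : ℕ
    g = gcd a b
    instance
      g≢0 : NonZero g
      g≢0 = ≢-nonZero (gcd[m,n]≢0 a b (inj₂ b≢0))

  coprime-solution⇒3∤a : Coprime a b → Solution a b c → 3 ∤ a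
  coprime-solution⇒3∤a {b = b} {c} coprime (solution eq) 3∣a@(divides α refl) =
    let d , U≡3d² = prime-cube*m≡square⇒ {c = c} prime[3] (trans (sym (expand α b)) eq)
        3∣b⁴ = ∣m+n∣m⇒∣n (divides (d * d) (trans U≡3d² (*-comm 3 (d * d))))
                         (m∣m*n (α * α * (α * α) + α * α * (b * b)))
    in coprime⇒∤ coprime prime[3] 3∣a (prime∣m*m⇒∣m prime[3] (prime∣m*m⇒∣m prime[3] 3∣b⁴))
    where
    expand : ∀ α b → α * 3 * (α * 3) * (α * 3 * (α * 3)) + 9 * (α * 3 * (α * 3)) * (b * b) + 27 * (b * b * (b * b))
                     ≡ 27 * (3 * (α * α * (α * α) + α * α * (b * b)) + b * b * (b * b))
    expand = solve-∀

  coprime-solution⇒even-solution : Coprime a b → 3 ∤ a → 0 < b → Solution a b c →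
    ∃[ a′ ] ∃[ w ] ∃[ c′ ] 3 ∤ a′ × Coprime a′ w × 0 < w × w ≤ b × Solution a′ (2 * w) c′
  coprime-solution⇒even-solution {a} {b} {c} coprime 3∤a 0<b sol with even⊎odd b
  ... | w , inj₁ refl =
    a , w , c , 3∤a , coprime-∣ʳ (n∣m*n 2) coprime , ∣⇒0< (n∣m*n 2) 0<b , m≤n*m w 2 , sol
  ... | k , inj₂ refl = 2 * a , b , 2 * 2 * c , 3∤2a , coprime-2a-b , 0<b , ≤-refl , scale-solution 2 sol
    where
    3∤2a : 3 ∤ 2 * a
    3∤2a 3∣2a = case euclidsLemma 2 a prime[3] 3∣2a of λ where
      (inj₁ 3∣2) → <⇒≱ (n<1+n 2) (∣⇒≤ 3∣2)
      (inj₂ 3∣a) → 3∤a 3∣a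
    2∤b : 2 ∤ b
    2∤b (divides j b≡j*2) = even≢odd j k (trans (*-comm 2 j) (sym b≡j*2))
    coprime-2a-b : Coprime (2 * a) b
    coprime-2a-b = no-common-prime⇒coprime λ q-prime q∣2a q∣b → case euclidsLemma 2 a q-prime q∣2a of λ where
      (inj₁ q∣2) → 2∤b (subst (_∣ b) (prime∣prime⇒≡ prime[2] q-prime q∣2) q∣b)
      (inj₂ q∣a) → coprime⇒∤ coprime q-prime q∣a q∣b

  -- Halving X² − Y² gives X = F + (F + Y) with F·(F + Y) = p³w⁴, and F, F + Y are coprime.
  split-step : Prime p → p ∤ Y → Coprime w Y → X * X ≡ Y * Y + 4 * (p * p * p * (w * w * (w * w))) →
    ∃₂ λ r s → r * s ≡ w ×
      (X ≡ r * r * (r * r) + p * p * p * (s * s * (s * s)) × p * p * p * (s * s * (s * s)) ≡ r * r * (r * r) + Y ⊎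
       X ≡ p * p * p * (r * r * (r * r)) + s * s * (s * s) × s * s * (s * s) ≡ p * p * p * (r * r * (r * r)) + Y)
  split-step {p} {Y} {w} {X} p-prime p∤Y coprime-wY X*X≡Y*Y+4p³w⁴
    with m*m≡n*n+4k⇒ X Y (p * p * p * (w * w * (w * w))) X*X≡Y*Y+4p³w⁴
  ... | f , f[f+Y]≡p³w⁴ , refl with coprime-cube-split {c = w} p-prime coprime-f[f+Y] f[f+Y]≡p³w⁴
    where
    coprime-Yf : Coprime Y f
    coprime-Yf = no-common-prime⇒coprime λ {q} q-prime q∣Y q∣f →
      let q∣p³w⁴ = subst (q ∣_) f[f+Y]≡p³w⁴ (∣m⇒∣m*n (f + Y) q∣f)
      in case euclidsLemma (p * p * p) (w * w * (w * w)) q-prime q∣p³w⁴ of λ where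
        (inj₁ q∣p³) → coprime⇒∤ (prime∤⇒coprime-cube p-prime p∤Y) q-prime q∣p³ q∣Y
        (inj₂ q∣w⁴) → coprime⇒∤ coprime-wY q-prime (prime∣m*m⇒∣m q-prime (prime∣m*m⇒∣m q-prime q∣w⁴)) q∣Y
    coprime-f[f+Y] : Coprime f (f + Y)
    coprime-f[f+Y] = Coprime.sym (Coprime.coprime-+ coprime-Yf)
  ... | r , s , r*s≡w , inj₁ (refl , f+Y≡p³s⁴) =
    r , s , r*s≡w , inj₁ (cong (r * r * (r * r) +_) f+Y≡p³s⁴ , sym f+Y≡p³s⁴)
  ... | r , s , r*s≡w , inj₂ (refl , f+Y≡s⁴) =
    r , s , r*s≡w , inj₂ (cong (p * p * p * (r * r * (r * r)) +_) f+Y≡s⁴ , sym f+Y≡s⁴)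

  first-descent : 3 ∤ a → Coprime a w → Solution a (2 * w) c →
    ∃₂ λ r s → r * s ≡ w × s * s * (s * s) ≡ 18 * (r * r) * (s * s) + 27 * (r * r * (r * r)) + a * a
  first-descent {a} {w} {c} 3∤a coprime (solution eq) =
    case split-step {X = c} prime[3] 3∤Y coprime-wY (trans (sym eq) (complete-square a w)) of λ where
      (r , s , _ , inj₁ (_ , 27s⁴≡r⁴+Y)) →
        contradiction (3∣m*m+n*n⇒3∣m {n = r * r} (3∣a²+r⁴ r s 27s⁴≡r⁴+Y)) 3∤a
      (r , s , r*s≡w , inj₂ (_ , s⁴≡27r⁴+Y)) → r , s , r*s≡w ,
        trans s⁴≡27r⁴+Y (trans (cong (λ v → 27 * (r * r * (r * r)) + (a * a + 18 * (v * v))) (sym r*s≡w)) (regroup a r s))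
    where
    complete-square : ∀ a w → a * a * (a * a) + 9 * (a * a) * (2 * w * (2 * w)) + 27 * (2 * w * (2 * w) * (2 * w * (2 * w)))
                              ≡ (a * a + 18 * (w * w)) * (a * a + 18 * (w * w)) + 4 * (27 * (w * w * (w * w)))
    complete-square = solve-∀
    3∣18w² : 3 ∣ 18 * (w * w)
    3∣18w² = ∣m⇒∣m*n (w * w) (divides 6 refl)
    3∤Y : 3 ∤ a * a + 18 * (w * w)
    3∤Y 3∣Y = 3∤a (prime∣m*m+n⇒∣m prime[3] 3∣18w² 3∣Y)
    coprime-wY : Coprime w (a * a + 18 * (w * w))
    coprime-wY = no-common-prime⇒coprime λ q-prime q∣w q∣Y →
      coprime⇒∤ coprime q-prime (prime∣m*m+n⇒∣m q-prime (∣n⇒∣m*n 18 (∣m⇒∣m*n w q∣w)) q∣Y) q∣w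
    3∣a²+r⁴ : ∀ r s → 27 * (s * s * (s * s)) ≡ r * r * (r * r) + (a * a + 18 * (w * w)) → 3 ∣ a * a + r * r * (r * r)
    3∣a²+r⁴ r s 27s⁴≡r⁴+Y = ∣m+n∣m⇒∣n
      (subst (3 ∣_) (trans 27s⁴≡r⁴+Y (regroup a r w)) (∣m⇒∣m*n (s * s * (s * s)) (divides 9 refl))) 3∣18w²
      where
      regroup : ∀ a r w → r * r * (r * r) + (a * a + 18 * (w * w)) ≡ 18 * (w * w) + (a * a + r * r * (r * r))
      regroup = solve-∀
    regroup : ∀ a r s → 27 * (r * r * (r * r)) + (a * a + 18 * (r * s * (r * s)))
                        ≡ 18 * (r * r) * (s * s) + 27 * (r * r * (r * r)) + a * a
    regroup = solve-∀

  private
    9r²≤s² : s * s * (s * s) ≡ 18 * (r * r) * (s * s) + 27 * (r * r * (r * r)) + t * t → 9 * (r * r) ≤ s * s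
    9r²≤s² {r = zero} _ = z≤n
    9r²≤s² {s} {r = r@(suc _)} {t} eq = ≮⇒≥ λ s²<9r² → <-irrefl refl (begin-strict
      s * s * (s * s)                                       ≤⟨ *-monoˡ-≤ (s * s) (<⇒≤ s²<9r²) ⟩
      9 * (r * r) * (s * s)                                 ≤⟨ *-monoˡ-≤ (s * s) (*-monoˡ-≤ (r * r) (m≤m+n 9 9)) ⟩
      18 * (r * r) * (s * s)                                <⟨ m<m+n _ z<s ⟩
      18 * (r * r) * (s * s) + 27 * (r * r * (r * r))       ≤⟨ m≤m+n _ (t * t) ⟩
      18 * (r * r) * (s * s) + 27 * (r * r * (r * r)) + t * t ≡⟨ eq ⟨
      s * s * (s * s)                                       ∎)
      where open ≤-Reasoning

  second-descent : 3 ∤ t → Coprime r t → s * s * (s * s) ≡ 18 * (r * r) * (s * s) + 27 * (r * r * (r * r)) + t * t →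
    ∃[ a ] ∃[ b ] ∃[ c ] b ∣ r × Solution a b c
  second-descent {t} {r} {s} 3∤t coprime eq =
    let m , 9r²+m≡s² = m≤n⇒∃[o]m+o≡n (9r²≤s² {s = s} {r = r} {t = t} eq)
    in case split-step {X = m} prime[3] 3∤t coprime (m*m≡t*t+4*27r⁴ m 9r²+m≡s²) of λ where
      (u , v , u*v≡r , inj₁ (m≡u⁴+27v⁴ , _)) →
        u , v , s , divides u (sym u*v≡r) , new-solution u v m 9r²+m≡s² u*v≡r m≡u⁴+27v⁴
      (u , v , u*v≡r , inj₂ (m≡27u⁴+v⁴ , _)) →
        v , u , s , divides v (trans (sym u*v≡r) (*-comm u v)) ,
        new-solution v u m 9r²+m≡s² (trans (*-comm v u) u*v≡r)
          (trans m≡27u⁴+v⁴ (+-comm (27 * (u * u * (u * u))) (v * v * (v * v))))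
    where
    open ≡-Reasoning
    m*m≡t*t+4*27r⁴ : ∀ m → 9 * (r * r) + m ≡ s * s → m * m ≡ t * t + 4 * (27 * (r * r * (r * r)))
    m*m≡t*t+4*27r⁴ m 9r²+m≡s² = +-cancelʳ-≡ (18 * (r * r) * m + 81 * (r * r * (r * r))) _ _ (begin
      m * m + (18 * (r * r) * m + 81 * (r * r * (r * r)))                 ≡⟨ expand r m ⟩
      (9 * (r * r) + m) * (9 * (r * r) + m)                              ≡⟨ cong (λ k → k * k) 9r²+m≡s² ⟩
      s * s * (s * s)                                                    ≡⟨ eq ⟩
      18 * (r * r) * (s * s) + 27 * (r * r * (r * r)) + t * t
        ≡⟨ cong (λ k → 18 * (r * r) * k + 27 * (r * r * (r * r)) + t * t) 9r²+m≡s² ⟨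
      18 * (r * r) * (9 * (r * r) + m) + 27 * (r * r * (r * r)) + t * t  ≡⟨ regroup r m t ⟩
      t * t + 4 * (27 * (r * r * (r * r))) + (18 * (r * r) * m + 81 * (r * r * (r * r))) ∎)
      where
      expand : ∀ r m → m * m + (18 * (r * r) * m + 81 * (r * r * (r * r))) ≡ (9 * (r * r) + m) * (9 * (r * r) + m)
      expand = solve-∀
      regroup : ∀ r m t → 18 * (r * r) * (9 * (r * r) + m) + 27 * (r * r * (r * r)) + t * t
                          ≡ t * t + 4 * (27 * (r * r * (r * r))) + (18 * (r * r) * m + 81 * (r * r * (r * r)))
      regroup = solve-∀
    new-solution : ∀ x y m → 9 * (r * r) + m ≡ s * s → x * y ≡ r →
               m ≡ x * x * (x * x) + 27 * (y * y * (y * y)) → Solution x y s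
    new-solution x y m 9r²+m≡s² x*y≡r m≡x⁴+27y⁴ = solution (begin
      x * x * (x * x) + 9 * (x * x) * (y * y) + 27 * (y * y * (y * y))  ≡⟨ regroup x y ⟩
      9 * (x * y * (x * y)) + (x * x * (x * x) + 27 * (y * y * (y * y)))
                                                                       ≡⟨ cong₂ (λ k l → 9 * (k * k) + l) x*y≡r (sym m≡x⁴+27y⁴) ⟩
      9 * (r * r) + m                                                  ≡⟨ 9r²+m≡s² ⟩
      s * s                                                            ∎)
      where
      regroup : ∀ x y → x * x * (x * x) + 9 * (x * x) * (y * y) + 27 * (y * y * (y * y))
                        ≡ 9 * (x * y * (x * y)) + (x * x * (x * x) + 27 * (y * y * (y * y)))
      regroup = solve-∀

  private
    1<s : 0 < r → s * s * (s * s) ≡ 18 * (r * r) * (s * s) + 27 * (r * r * (r * r)) + t * t → 1 < s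
    1<s {r} {s} {t} 0<r eq = ≰⇒> λ s≤1 → <⇒≱ (s≤s (s≤s z≤n)) (begin
      27                                                      ≤⟨ *-monoʳ-≤ 27 (*-mono-≤ (*-mono-≤ 0<r 0<r) (*-mono-≤ 0<r 0<r)) ⟩
      27 * (r * r * (r * r))                                  ≤⟨ m≤n+m _ (18 * (r * r) * (s * s)) ⟩
      18 * (r * r) * (s * s) + 27 * (r * r * (r * r))         ≤⟨ m≤m+n _ (t * t) ⟩
      18 * (r * r) * (s * s) + 27 * (r * r * (r * r)) + t * t ≡⟨ eq ⟨
      s * s * (s * s)                                         ≤⟨ *-mono-≤ (*-mono-≤ s≤1 s≤1) (*-mono-≤ s≤1 s≤1) ⟩
      1                                                       ∎)
      where open ≤-Reasoning

  descent : Coprime a b → 0 < b → Solution a b c →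
    ∃[ a′ ] ∃[ b′ ] ∃[ c′ ] 0 < b′ × b′ < b × Solution a′ b′ c′
  descent coprime 0<b sol =
    case coprime-solution⇒even-solution coprime (coprime-solution⇒3∤a coprime sol) 0<b sol of λ where
      (A , w , _ , 3∤A , coprime-Aw , 0<w , w≤b , sol₁) → case first-descent 3∤A coprime-Aw sol₁ of λ where
        (r , s , refl , eq) →
          case second-descent {s = s} 3∤A (Coprime.sym (coprime-∣ʳ (m∣m*n s) coprime-Aw)) eq of λ where
          (a′ , b′ , c′ , b′∣r , sol′) →
            let 0<r = ∣⇒0< (m∣m*n s) 0<w
                r<r*s = m<m*n r s {{>-nonZero 0<r}} (1<s {r = r} {s = s} {t = A} 0<r eq)
                b′<b = <-≤-trans (≤-<-trans (∣⇒≤ {{>-nonZero 0<r}} b′∣r) r<r*s) w≤b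
            in a′ , b′ , c′ , ∣⇒0< b′∣r 0<r , b′<b , sol′

  no-solution : ∀ b → 0 < b → ∀ {a c} → ¬ Solution a b c
  no-solution = <-rec _ λ b smaller 0<b {_} {_} sol → case primitive-solution 0<b sol of λ where
    (_ , b₀ , _ , coprime , b₀∣b , sol₀) → case descent coprime (∣⇒0< b₀∣b 0<b) sol₀ of λ where
      (_ , b₁ , _ , 0<b₁ , b₁<b₀ , sol₁) →
        smaller (<-≤-trans b₁<b₀ (∣⇒≤ {{>-nonZero 0<b}} b₀∣b)) 0<b₁ sol₁

open import Data.Integer using (ℤ; _+_; _*_; _^_; +_; ∣_∣; -[1+_]; +[1+_])
open import Data.Integer.Properties using (pos-*; +-injective; ∣i∣≡0⇒i≡0; *-identityʳ; ^-distribˡ-+-*)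
import Data.Nat as ℕ
open import Data.Nat.Properties using (n≢0⇒n>0)
open import Function.Base using (_∘_)
open import Relation.Binary.PropositionalEquality using (_≡_; refl; sym; trans; cong; cong₂; module ≡-Reasoning)
open import Relation.Nullary using (¬_)

i*i≡∣i∣*∣i∣ : ∀ i → i * i ≡ + (∣ i ∣ ℕ.* ∣ i ∣)
i*i≡∣i∣*∣i∣ (+ 0) = refl
i*i≡∣i∣*∣i∣ +[1+ n ] = refl
i*i≡∣i∣*∣i∣ -[1+ n ] = refl

i^2≡∣i∣*∣i∣ : ∀ i → i ^ 2 ≡ + (∣ i ∣ ℕ.* ∣ i ∣)
i^2≡∣i∣*∣i∣ i = trans (cong (i *_) (*-identityʳ i)) (i*i≡∣i∣*∣i∣ i)

i^4≡∣i∣⁴ : ∀ i → i ^ 4 ≡ + (∣ i ∣ ℕ.* ∣ i ∣ ℕ.* (∣ i ∣ ℕ.* ∣ i ∣))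
i^4≡∣i∣⁴ i = trans (^-distribˡ-+-* i 2 2)
  (trans (cong₂ _*_ (i^2≡∣i∣*∣i∣ i) (i^2≡∣i∣*∣i∣ i)) (sym (pos-* (∣ i ∣ ℕ.* ∣ i ∣) (∣ i ∣ ℕ.* ∣ i ∣))))

pos-form : ∀ p q r s → + p + + 9 * + q * + r + + 27 * + s ≡ + (p ℕ.+ 9 ℕ.* q ℕ.* r ℕ.+ 27 ℕ.* s)
pos-form p q r s rewrite sym (pos-* 9 q) | sym (pos-* (9 ℕ.* q) r) | sym (pos-* 27 s) = refl

abs-solution : ∀ x y z → x ^ 4 + + 9 * (x ^ 2) * (y ^ 2) + + 27 * (y ^ 4) ≡ z ^ 2 → Solution (∣ x ∣) (∣ y ∣) (∣ z ∣)
abs-solution x y z eq = solution (+-injective (begin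
  + (X⁴ ℕ.+ 9 ℕ.* X² ℕ.* Y² ℕ.+ 27 ℕ.* Y⁴)      ≡⟨ pos-form X⁴ X² Y² Y⁴ ⟨
  + X⁴ + + 9 * + X² * + Y² + + 27 * + Y⁴
    ≡⟨ cong₂ _+_ (cong₂ _+_ (i^4≡∣i∣⁴ x) (cong₂ (λ u v → + 9 * u * v) (i^2≡∣i∣*∣i∣ x) (i^2≡∣i∣*∣i∣ y)))
                 (cong (+ 27 *_) (i^4≡∣i∣⁴ y)) ⟨
  x ^ 4 + + 9 * (x ^ 2) * (y ^ 2) + + 27 * (y ^ 4) ≡⟨ eq ⟩
  z ^ 2                                           ≡⟨ i^2≡∣i∣*∣i∣ z ⟩
  + (∣ z ∣ ℕ.* ∣ z ∣)                             ∎))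
  where
  open ≡-Reasoning
  X² X⁴ Y² Y⁴ : ℕ.ℕ
  X² = ∣ x ∣ ℕ.* ∣ x ∣
  X⁴ = X² ℕ.* X²
  Y² = ∣ y ∣ ℕ.* ∣ y ∣
  Y⁴ = Y² ℕ.* Y²

mainTheorem2 : (x y z : ℤ) → ¬ x ≡ + 0 → ¬ y ≡ + 0 → ¬ z ≡ + 0 →
    ¬ (x ^ 4 + + 9 * (x ^ 2) * (y ^ 2) + + 27 * (y ^ 4) ≡ z ^ 2)
mainTheorem2 x y z _ y≢0 _ eq = no-solution ∣ y ∣ (n≢0⇒n>0 (y≢0 ∘ ∣i∣≡0⇒i≡0)) (abs-solution x y z eq)
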